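{- Let $n\ge2$ and let $\underline{a}=a_1\cdots a_n$ be a word of $G_n$. If $\underline{a}$ is in an increasing run, then $a_1+\cdots+a_{n-1}+(n-2)\equiv1\pmod2$, and if $\underline{a}$ is in a decreasing run, then $a_1+\cdots+a_{n-1}+(n-2)\equiv0\pmod2$.
   Context: The list $G_n$ of words $a_1\cdots a_n$ (with $1\le a_i\le 2i-1$) is defined recursively: $G_1=(1)$; for $n\ge2$, if $G_{n-1}=(w_1,\ldots,w_N)$, then $G_n$ is the concatenation over $m=1,\ldots,N$ of the blocks $(w_m1,w_m2,\ldots,w_m(2n-1))$ for $m$ odd and $(w_m(2n-1),\ldots,w_m1)$ for $m$ even, where $w_mx$ denotes $w_m$ with the letter $x$ appended. The $m$-th block is called the $m$-th run of $G_n$; it is an increasing run if $m$ is odd and a decreasing run if $m$ is even. -}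

module Defs where

open import Data.Nat using (ℕ; zero; suc; _+_; _*_; _∸_)
open import Data.Nat using () renaming (_%_ to _%ℕ_)
open import Data.List using (List; []; _∷_; _++_; [_]; map; concat; reverse; upTo; length)

oneTo : ℕ → List ℕ
oneTo k = map suc (upTo k)

data Par : Set where
  odd even : Par

flip : Par → Par
flip odd = even
flip even = odd

block : ℕ → Par → List ℕ → List (List ℕ)
block k odd  w = map (λ x → w ++ [ x ]) (oneTo k)
block k even w = map (λ x → w ++ [ x ]) (reverse (oneTo k))

blocks : ℕ → Par → List (List ℕ) → List (List (List ℕ))
blocks k p [] = []
blocks k p (w ∷ ws) = block k p w ∷ blocks k (flip p) ws

mutual
  -- G n : the list G_n (for n ≥ 1); G 0 is the list containing the empty word
  -- (only used as an auxiliary base, G 1 = ((1))).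
  G : ℕ → List (List ℕ)
  G zero = [] ∷ []
  G (suc n) = concat (runs (suc n))

  -- runs n : the runs of G_n, in order; the m-th run (1-indexed) is
  -- increasing if m is odd and decreasing if m is even.
  runs : ℕ → List (List (List ℕ))
  runs zero = ([] ∷ []) ∷ []
  runs (suc n) = blocks (suc (2 * n)) odd (G n)

module Submission where

-- Consecutive words of G_m have letter sums of alternating
-- parity, starting from the all-ones word 1⋯1 of sum m: inside a run only
-- the last letter moves, by one; between two runs the prefix moves to the
-- next word of G_{m-1} (parity flips by induction) while the last letter is
-- repeated (2m-1 ending one run, beginning the next, or 1 twice).  Hence the
-- j-th word (counted from 0) of G_m has sum of parity m + j.
--
-- Finally a word in the i-th run of G_{k+2}
-- is u x with u the i-th word of G_{k+1}, so its first k+1 letters sum to a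
-- number of parity (k+1) + i, and adding k gives parity i + 1, which is the
-- claim of Corollary 5.3 (the run is increasing iff i + 1 is odd).

open import Defs
open import Data.Nat using (ℕ; _+_; _∸_; _≤_; _%_)
open import Data.List using (List; length; lookup; take)
open import Data.Nat.ListAction using (sum)
open import Data.List.Membership.Propositional using (_∈_)
open import Data.Fin using (Fin; toℕ)
open import Relation.Binary.PropositionalEquality using (_≡_)
open import Data.Product using (_×_)

open import Data.Nat using (zero; suc; _*_; s≤s; z≤n; parity)
open import Data.Nat.Properties using (+-comm; +-identityʳ)
open import Data.Parity.Base using (Parity; 0ℙ; 1ℙ; _⁻¹) renaming (_+_ to _⊕_)
open import Data.Parity.Properties using (suc-homo-⁻¹; ⁻¹-selfInverse; +-homo-+; *-homo-*)
  renaming (+-identityʳ to ⊕-identityʳ; +-comm to ⊕-comm)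
open import Data.List using ([]; _∷_; _++_; [_]; map; concat; reverse; upTo; applyUpTo; applyDownFrom; downFrom)
open import Data.List.Properties using (length-++; length-map; length-applyUpTo; length-applyDownFrom; map-upTo; reverse-map; reverse-upTo; map-downFrom)
open import Data.Nat.ListAction.Properties using (sum-++)
open import Data.List.Relation.Unary.All as All using (All; []; _∷_)
open import Data.List.Relation.Unary.All.Properties using (concat⁺; map⁺)
open import Data.List.Membership.Propositional.Properties using (∈-map⁻; ∈-lookup)
open import Data.Fin using (zero; suc)
open import Data.Product using (_,_; ∃-syntax)
open import Relation.Binary.PropositionalEquality using (refl; sym; trans; cong; subst; module ≡-Reasoning)

open ≡-Reasoning

parity-suc : ∀ n → parity (suc n) ≡ parity n ⁻¹
parity-suc n = sym (⁻¹-selfInverse (suc-homo-⁻¹ n))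

parity-odd : ∀ n → parity (suc (2 * n)) ≡ 1ℙ
parity-odd n = trans (parity-suc (2 * n)) (cong _⁻¹ (*-homo-* 2 n))

⁻¹-⊕-parity : ∀ p n → p ⁻¹ ⊕ parity n ≡ p ⊕ parity (suc n)
⁻¹-⊕-parity 0ℙ n = sym (parity-suc n)
⁻¹-⊕-parity 1ℙ n = sym (suc-homo-⁻¹ n)

⊕-⁻¹ : ∀ c p → c ⊕ p ⁻¹ ≡ (c ⊕ p) ⁻¹
⊕-⁻¹ 0ℙ p = refl
⊕-⁻¹ 1ℙ p = refl

⁻¹-⊕-cancel : ∀ p q → (p ⁻¹ ⊕ q) ⊕ p ≡ q ⊕ 1ℙ
⁻¹-⊕-cancel 0ℙ 0ℙ = refl
⁻¹-⊕-cancel 0ℙ 1ℙ = refl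
⁻¹-⊕-cancel 1ℙ 0ℙ = refl
⁻¹-⊕-cancel 1ℙ 1ℙ = refl

bit : Parity → ℕ
bit 0ℙ = 0
bit 1ℙ = 1

%2≡bit-parity : ∀ n → n % 2 ≡ bit (parity n)
%2≡bit-parity zero = refl
%2≡bit-parity (suc zero) = refl
%2≡bit-parity (suc (suc n)) = %2≡bit-parity n

%2-respects-parity : ∀ m n → parity m ≡ parity n → m % 2 ≡ n % 2
%2-respects-parity m n eq = begin
  m % 2             ≡⟨ %2≡bit-parity m ⟩
  bit (parity m)    ≡⟨ cong bit eq ⟩
  bit (parity n)    ≡⟨ sym (%2≡bit-parity n) ⟩
  n % 2             ∎

data Alternating {A : Set} (f : A → ℕ) : Parity → List A → Set where
  []  : ∀ {p} → Alternating f p []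
  _∷_ : ∀ {p x xs} → parity (f x) ≡ p → Alternating f (p ⁻¹) xs → Alternating f p (x ∷ xs)

module _ {A : Set} {f : A → ℕ} where

  alternating-lookup : ∀ {p xs} → Alternating f p xs → (j : Fin (length xs)) →
                       parity (f (lookup xs j)) ≡ p ⊕ parity (toℕ j)
  alternating-lookup {p} (e ∷ _) zero = trans e (sym (⊕-identityʳ p))
  alternating-lookup {p} (_ ∷ a) (suc j) = trans (alternating-lookup a j) (⁻¹-⊕-parity p (toℕ j))

  alternating-++ : ∀ {p} xs {ys} → Alternating f p xs →
                   Alternating f (p ⊕ parity (length xs)) ys → Alternating f p (xs ++ ys)
  alternating-++ {p} [] {ys} [] b = subst (λ q → Alternating f q ys) (⊕-identityʳ p) b
  alternating-++ {p} (x ∷ xs) {ys} (e ∷ a) b =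
    e ∷ alternating-++ xs a (subst (λ q → Alternating f q ys) (sym (⁻¹-⊕-parity p (length xs))) b)

  alternating-map : ∀ {B : Set} {h : B → ℕ} {g : B → A} c {p xs} →
                    (∀ x → parity (f (g x)) ≡ c ⊕ parity (h x)) →
                    Alternating h p xs → Alternating f (c ⊕ p) (map g xs)
  alternating-map c shift [] = []
  alternating-map {g = g} c {p} {x ∷ xs} shift (e ∷ a) =
    trans (shift x) (cong (c ⊕_) e) ∷
    subst (λ q → Alternating f q (map g xs)) (⊕-⁻¹ c p) (alternating-map c shift a)

applyUpTo-alternating : ∀ (f : ℕ → ℕ) → (∀ i → parity (f (suc i)) ≡ parity (f i) ⁻¹) →
                        ∀ m → Alternating (λ x → x) (parity (f 0)) (applyUpTo f m)
applyUpTo-alternating f step zero = []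
applyUpTo-alternating f step (suc m) =
  refl ∷ subst (λ q → Alternating (λ x → x) q (applyUpTo (λ i → f (suc i)) m)) (step 0)
               (applyUpTo-alternating (λ i → f (suc i)) (λ i → step (suc i)) m)

descending-alternating : ∀ m → Alternating (λ x → x) (parity m) (applyDownFrom suc m)
descending-alternating zero = []
descending-alternating (suc m) =
  refl ∷ subst (λ q → Alternating (λ x → x) q (applyDownFrom suc m)) (sym (suc-homo-⁻¹ m)) (descending-alternating m)

letters : ℕ → Par → List ℕ
letters K odd = applyUpTo suc K
letters K even = applyDownFrom suc K

length-letters : ∀ K p → length (letters K p) ≡ K
length-letters K odd = length-applyUpTo suc K
length-letters K even = length-applyDownFrom suc K

-- For odd K both orders start with an odd letter (1 resp. K).
letters-alternating : ∀ n p → Alternating (λ x → x) 1ℙ (letters (suc (2 * n)) p)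
letters-alternating n odd = applyUpTo-alternating suc (λ i → parity-suc (suc i)) (suc (2 * n))
letters-alternating n even =
  subst (λ q → Alternating (λ x → x) q (applyDownFrom suc (suc (2 * n))))
        (parity-odd n) (descending-alternating (suc (2 * n)))

block≡ : ∀ K p w → block K p w ≡ map (λ x → w ++ [ x ]) (letters K p)
block≡ K odd w = cong (map (λ x → w ++ [ x ])) (map-upTo suc K)
block≡ K even w = cong (map (λ x → w ++ [ x ])) (begin
  reverse (map suc (upTo K))   ≡⟨ sym (reverse-map suc (upTo K)) ⟩
  map suc (reverse (upTo K))   ≡⟨ cong (map suc) (reverse-upTo K) ⟩
  map suc (downFrom K)         ≡⟨ map-downFrom suc K ⟩
  applyDownFrom suc K          ∎)

length-block : ∀ K p w → length (block K p w) ≡ K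
length-block K p w rewrite block≡ K p w = trans (length-map _ (letters K p)) (length-letters K p)

parity-sum-snoc : ∀ w x → parity (sum (w ++ [ x ])) ≡ parity (sum w) ⊕ parity x
parity-sum-snoc w x = begin
  parity (sum (w ++ [ x ]))      ≡⟨ cong parity (sum-++ w [ x ]) ⟩
  parity (sum w + (x + 0))       ≡⟨ cong (λ y → parity (sum w + y)) (+-identityʳ x) ⟩
  parity (sum w + x)             ≡⟨ +-homo-+ (sum w) x ⟩
  parity (sum w) ⊕ parity x      ∎

length-snoc : ∀ {k} (w : List ℕ) x → length w ≡ k → length (w ++ [ x ]) ≡ suc k
length-snoc w x refl = trans (length-++ w {[ x ]}) (+-comm (length w) 1)

∈-block : ∀ K p u {w} → w ∈ block K p u → ∃[ x ] w ≡ u ++ [ x ]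
∈-block K p u w∈run with ∈-map⁻ (λ x → u ++ [ x ]) (subst (_ ∈_) (block≡ K p u) w∈run)
... | x , _ , w≡ux = x , w≡ux

take-snoc : ∀ (u : List ℕ) x {m} → length u ≡ m → take m (u ++ [ x ]) ≡ u
take-snoc [] x refl = refl
take-snoc (y ∷ u) x refl = cong (y ∷_) (take-snoc u x refl)

lookup-blocks : ∀ K p ws (i : Fin (length (blocks K p ws))) →
  ∃[ j ] toℕ j ≡ toℕ i × ∃[ p′ ] lookup (blocks K p ws) i ≡ block K p′ (lookup ws j)
lookup-blocks K p (w ∷ ws) zero = zero , refl , p , refl
lookup-blocks K p (w ∷ ws) (suc i) with lookup-blocks K (flip p) ws i
... | j , j≡i , p′ , run≡block = suc j , cong suc j≡i , p′ , run≡block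

block-alternating : ∀ n p w → Alternating sum (parity (sum w) ⁻¹) (block (suc (2 * n)) p w)
block-alternating n p w rewrite block≡ (suc (2 * n)) p w =
  subst (λ q → Alternating sum q (map (λ x → w ++ [ x ]) (letters (suc (2 * n)) p)))
        (⊕-comm (parity (sum w)) 1ℙ)
        (alternating-map {g = λ x → w ++ [ x ]} (parity (sum w)) (parity-sum-snoc w) (letters-alternating n p))

-- Runs have odd length, so each next run starts with the flipped parity of the
-- next prefix exactly where the previous run stopped.
blocks-alternating : ∀ n p {q} ws → Alternating sum q ws →
                     Alternating sum (q ⁻¹) (concat (blocks (suc (2 * n)) p ws))
blocks-alternating n p [] [] = []
blocks-alternating n p {q} (w ∷ ws) (e ∷ a) =
  alternating-++ (block K p w)
    (subst (λ r → Alternating sum (r ⁻¹) (block K p w)) e (block-alternating n p w))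
    (subst (λ r → Alternating sum r (concat (blocks K (flip p) ws))) continue
           (blocks-alternating n (flip p) ws a))
  where
  K : ℕ
  K = suc (2 * n)
  continue : q ⁻¹ ⁻¹ ≡ q ⁻¹ ⊕ parity (length (block K p w))
  continue = begin
    q ⁻¹ ⁻¹                               ≡⟨ ⊕-comm 1ℙ (q ⁻¹) ⟩
    q ⁻¹ ⊕ 1ℙ                             ≡⟨ cong (q ⁻¹ ⊕_) (sym (parity-odd n)) ⟩
    q ⁻¹ ⊕ parity K                       ≡⟨ cong (λ l → q ⁻¹ ⊕ parity l) (sym (length-block K p w)) ⟩
    q ⁻¹ ⊕ parity (length (block K p w))  ∎

G-alternating : ∀ m → Alternating sum (parity m) (G m)
G-alternating zero = refl ∷ []
G-alternating (suc m) = subst (λ q → Alternating sum q (G (suc m))) (sym (parity-suc m))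
                              (blocks-alternating m odd (G m) (G-alternating m))

G-lengths : ∀ m → All (λ w → length w ≡ m) (G m)
G-lengths zero = refl ∷ []
G-lengths (suc m) = concat⁺ (blocks-lengths (G-lengths m))
  where
  blocks-lengths : ∀ {K p ws} → All (λ w → length w ≡ m) ws →
                   All (All (λ v → length v ≡ suc m)) (blocks K p ws)
  blocks-lengths [] = []
  blocks-lengths {K} {p} {w ∷ _} (l ∷ ls) =
    subst (All _) (sym (block≡ K p w)) (map⁺ (All.universal (λ x → length-snoc w x l) _))
    ∷ blocks-lengths ls

run-word-parity : ∀ k (i : Fin (length (runs (suc (suc k))))) w → w ∈ lookup (runs (suc (suc k))) i →
                  parity (sum (take (suc k) w) + k) ≡ parity (toℕ i + 1)
run-word-parity k i w w∈run with lookup-blocks (suc (2 * suc k)) odd (G (suc k)) i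
... | j , j≡i , p , run≡block with ∈-block _ p _ (subst (w ∈_) run≡block w∈run)
... | x , refl = begin
  parity (sum (take (suc k) (u ++ [ x ])) + k)   ≡⟨ cong (λ v → parity (sum v + k)) (take-snoc u x length-u) ⟩
  parity (sum u + k)                             ≡⟨ +-homo-+ (sum u) k ⟩
  parity (sum u) ⊕ parity k                      ≡⟨ cong (_⊕ parity k) (alternating-lookup (G-alternating (suc k)) j) ⟩
  (parity (suc k) ⊕ parity (toℕ j)) ⊕ parity k  ≡⟨ cong (λ r → (r ⊕ parity (toℕ j)) ⊕ parity k) (parity-suc k) ⟩
  (parity k ⁻¹ ⊕ parity (toℕ j)) ⊕ parity k     ≡⟨ ⁻¹-⊕-cancel (parity k) (parity (toℕ j)) ⟩
  parity (toℕ j) ⊕ 1ℙ                            ≡⟨ sym (+-homo-+ (toℕ j) 1) ⟩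
  parity (toℕ j + 1)                             ≡⟨ cong (λ m → parity (m + 1)) j≡i ⟩
  parity (toℕ i + 1)                             ∎
  where
  u : List ℕ
  u = lookup (G (suc k)) j
  length-u : length u ≡ suc k
  length-u = All.lookup (G-lengths (suc k)) (∈-lookup j)

corollary5p3 : (n : ℕ) → 2 ≤ n → (i : Fin (length (runs n))) → (w : List ℕ) →
    w ∈ lookup (runs n) i →
    ((toℕ i + 1) % 2 ≡ 1 → (sum (take (n ∸ 1) w) + (n ∸ 2)) % 2 ≡ 1) ×
    ((toℕ i + 1) % 2 ≡ 0 → (sum (take (n ∸ 1) w) + (n ∸ 2)) % 2 ≡ 0)
corollary5p3 (suc (suc k)) (s≤s (s≤s z≤n)) i w w∈run =
  (λ increasing → trans same-remainder increasing) ,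
  (λ decreasing → trans same-remainder decreasing)
  where
  same-remainder : (sum (take (suc k) w) + k) % 2 ≡ (toℕ i + 1) % 2
  same-remainder = %2-respects-parity (sum (take (suc k) w) + k) (toℕ i + 1) (run-word-parity k i w w∈run)
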